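{- Let $C_n$ be a chordless cycle with $n\ge 4$, and consider an IP-SEG model of $C_n$ not consisting exclusively of permutation segments. Then the model has either exactly one interval arc, or exactly two interval arcs, these two lying on different horizontal lines (one on $L_1$ and one on $L_2$).
   Context: Let $L_1$ and $L_2$ be the horizontal lines $y=1$ and $y=2$. An interval segment is a segment with both endpoints on the same $L_i$; a permutation segment has one endpoint on $L_1$ and the other on $L_2$. An IP-SEG model of a graph assigns to each vertex an interval or permutation segment so that two distinct vertices are adjacent iff their segments intersect. For a chordless cycle $C_n=(v_1,\dots,v_n)$ with a model containing both interval and permutation segments, with $s(v_i)$ the segment of $v_i$, an interval arc is a maximal sequence $(s(v_i),\dots,s(v_j))$ of segments of consecutive cycle vertices (indices modulo $n$) that are all interval segments, so that $s(v_{i-1})$ and $s(v_{j+1})$ are permutation segments. (All segments of an interval arc lie on the same line.) -}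

module Defs where

open import Level using (0ℓ)
open import Data.Nat using (ℕ; suc; _+_; _∸_; _<_; _≤_; NonZero)
open import Data.Nat.DivMod using (_%_; m%n<n)
open import Data.Fin using (Fin; toℕ; fromℕ<)
open import Data.Product using (_×_; ∃; ∃-syntax; Σ-syntax)
open import Data.Sum using (_⊎_)
open import Relation.Binary.Bundles using (TotalOrder)
open import Relation.Binary.PropositionalEquality using (_≡_)
open import Relation.Nullary using (¬_)
open import Data.Unit using (⊤)
open import Data.Empty using (⊥)

-- The two horizontal lines L₁ (y = 1) and L₂ (y = 2).
data Line : Set where
  L₁ L₂ : Line

module Geometry (O : TotalOrder 0ℓ 0ℓ 0ℓ) where
  open TotalOrder O using () renaming (Carrier to X; _≤_ to _≼_)

  -- A segment: x-coordinates range over an arbitrary total order (e.g. ℝ).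
  --  ival L a b : interval segment on line L with endpoints (a,L) and (b,L)
  --  perm p q   : permutation segment from (p,1) on L₁ to (q,2) on L₂
  data Seg : Set where
    ival : Line → X → X → Seg
    perm : X → X → Seg

  Between : X → X → X → Set
  Between a b x = (a ≼ x × x ≼ b) ⊎ (b ≼ x × x ≼ a)

  -- geometric intersection of two segments in the strip 1 ≤ y ≤ 2
  Meets : Seg → Seg → Set
  Meets (ival L a b) (ival L' c d) = L ≡ L' × ∃[ x ] (Between a b x × Between c d x)
  Meets (ival L₁ a b) (perm p q) = Between a b p
  Meets (ival L₂ a b) (perm p q) = Between a b q
  Meets (perm p q) (ival L₁ a b) = Between a b p
  Meets (perm p q) (ival L₂ a b) = Between a b q
  -- two straight segments between the lines cross iff their endpoint orders
  -- on L₁ and L₂ are (weakly) reversed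
  Meets (perm p q) (perm p' q') = (p ≼ p' × q' ≼ q) ⊎ (p' ≼ p × q ≼ q')

  IsInterval : Seg → Set
  IsInterval (ival _ _ _) = ⊤
  IsInterval (perm _ _) = ⊥

  IsPerm : Seg → Set
  IsPerm s = ¬ IsInterval s

  OnLine : Line → Seg → Set
  OnLine L (ival L' _ _) = L' ≡ L
  OnLine L (perm _ _) = ⊥

  shift : (n : ℕ) .{{_ : NonZero n}} → Fin n → ℕ → Fin n
  shift n i k = fromℕ< (m%n<n (toℕ i + k) n)

  CycleAdj : (n : ℕ) .{{_ : NonZero n}} → Fin n → Fin n → Set
  CycleAdj n i j = j ≡ shift n i 1 ⊎ i ≡ shift n j 1

  IsModel : (n : ℕ) .{{_ : NonZero n}} → (Fin n → Seg) → Set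
  IsModel n s = ∀ i j → ¬ i ≡ j →
    (Meets (s i) (s j) → CycleAdj n i j) × (CycleAdj n i j → Meets (s i) (s j))

  -- interval arc starting at vertex i of length ℓ:
  -- s(v_i),…,s(v_{i+ℓ-1}) interval segments, s(v_{i-1}), s(v_{i+ℓ}) permutation
  IsArc : (n : ℕ) .{{_ : NonZero n}} → (Fin n → Seg) → Fin n → ℕ → Set
  IsArc n s i ℓ =
    1 ≤ ℓ × ℓ < n
    × (∀ k → k < ℓ → IsInterval (s (shift n i k)))
    × IsPerm (s (shift n i ℓ))
    × IsPerm (s (shift n i (n ∸ 1)))

  ArcOn : (n : ℕ) .{{_ : NonZero n}} → (Fin n → Seg) → Fin n → ℕ → Line → Set
  ArcOn n s i ℓ L = ∀ k → k < ℓ → OnLine L (s (shift n i k))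

  ExactlyOneArc : (n : ℕ) .{{_ : NonZero n}} → (Fin n → Seg) → Set
  ExactlyOneArc n s = Σ[ i ∈ Fin n ] Σ[ ℓ ∈ ℕ ] (IsArc n s i ℓ
    × (∀ j m → IsArc n s j m → j ≡ i × m ≡ ℓ))

  ExactlyTwoArcsOnDifferentLines : (n : ℕ) .{{_ : NonZero n}} → (Fin n → Seg) → Set
  ExactlyTwoArcsOnDifferentLines n s =
    Σ[ i ∈ Fin n ] Σ[ ℓ ∈ ℕ ] Σ[ i' ∈ Fin n ] Σ[ ℓ' ∈ ℕ ]
      (IsArc n s i ℓ × IsArc n s i' ℓ' × ¬ i ≡ i'
      × ArcOn n s i ℓ L₁ × ArcOn n s i' ℓ' L₂
      × (∀ j m → IsArc n s j m → (j ≡ i × m ≡ ℓ) ⊎ (j ≡ i' × m ≡ ℓ')))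

module Submission where

-- The geometric engine is separation: a permutation segment π splits the strip, every
-- segment avoiding π lies strictly on one side of it, and two segments on opposite sides
-- do not meet; hence a property "right of π" spreads along any path of the cycle avoiding
-- π.  Vertical segments perm c c serve as probes for points c of a line.
--   1. (Plane) Betweenness in the total order, the separation lemma and its closure form.
--   2. (Cyclic) Arithmetic of the cyclic shift of vertex indices.
--   3. (CycleModel) Consecutive segments meet, non-consecutive ones do not; the model is
--      not made of interval segments only (Cₙ is not an interval graph), so arcs exist.
--      The key lemma: an interval segment on the line of an arc lies in that arc.  Hence two
--      arcs on the same line coincide, and since there are only two lines there are one or
--      two arcs, in the latter case on different lines.

open import Defs
open import Level using (0ℓ)
open import Data.Nat using (ℕ; zero; suc; _+_; _∸_; _≤_; _<_; NonZero; z≤n; s≤s; z<s; s<s; >-nonZero⁻¹)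
open import Data.Nat.Properties
open import Data.Nat.DivMod using (_%_; m%n<n; %-distribˡ-+; m%n%n≡m%n; [m+n]%n≡m%n; m<n⇒m%n≡m; n%n≡0)
open import Data.Fin using (Fin; toℕ)
open import Data.Fin.Properties using (toℕ-injective; toℕ-fromℕ<; toℕ<n; any?) renaming (_≟_ to _≟F_)
open import Data.Product using (Σ; _×_; _,_; proj₁; proj₂; ∃-syntax)
open import Data.Sum using (_⊎_; inj₁; inj₂)
open import Data.Empty using (⊥; ⊥-elim)
open import Data.Unit using (tt)
open import Function using (_∘_)
open import Relation.Nullary using (¬_; Dec; yes; no; ¬?)
open import Relation.Nullary.Decidable using (_×-dec_)
open import Relation.Binary.Definitions using (tri<; tri≈; tri>)
open import Relation.Binary.PropositionalEquality using (_≡_; refl; sym; trans; cong; subst; module ≡-Reasoning)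
open import Relation.Binary.Bundles using (TotalOrder)

module Plane (O : TotalOrder 0ℓ 0ℓ 0ℓ) where
  open TotalOrder O using (total) renaming (Carrier to X; _≤_ to _≼_; refl to ≼-refl; trans to ≼-trans)
  import Relation.Binary.Properties.TotalOrder O as TotalOrderProperties
  open Geometry O

  -- The strict order, in the form available constructively in a total order.
  _≺_ : X → X → Set
  x ≺ y = ¬ (y ≼ x)

  ≺⇒≼ : ∀ {x y} → x ≺ y → x ≼ y
  ≺⇒≼ = TotalOrderProperties.≰⇒≥

  ≺-≼-trans : ∀ {x y z} → x ≺ y → y ≼ z → x ≺ z
  ≺-≼-trans x≺y y≼z z≼x = x≺y (≼-trans y≼z z≼x)

  ≼-≺-trans : ∀ {x y z} → x ≼ y → y ≺ z → x ≺ z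
  ≼-≺-trans x≼y y≺z z≼x = y≺z (≼-trans z≼x x≼y)

  ≺-asym : ∀ {x y} → x ≺ y → y ≺ x → ⊥
  ≺-asym x≺y y≺x = y≺x (≺⇒≼ x≺y)

  Below : X → X → X → Set
  Below p c d = p ≺ c × p ≺ d

  Above : X → X → X → Set
  Above p c d = c ≺ p × d ≺ p

  between-self : ∀ c d → Between c d c
  between-self c d with total c d
  ... | inj₁ c≼d = inj₁ (≼-refl , c≼d)
  ... | inj₂ d≼c = inj₂ (d≼c , ≼-refl)

  between-convex : ∀ {e f a b g} → Between e f a → Between e f b → a ≼ g → g ≼ b → Between e f g
  between-convex (inj₁ (e≼a , a≼f)) (inj₁ (e≼b , b≼f)) a≼g g≼b = inj₁ (≼-trans e≼a a≼g , ≼-trans g≼b b≼f)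
  between-convex (inj₂ (f≼a , a≼e)) (inj₂ (f≼b , b≼e)) a≼g g≼b = inj₂ (≼-trans f≼a a≼g , ≼-trans g≼b b≼e)
  between-convex {f = f} {g = g} (inj₁ (e≼a , a≼f)) (inj₂ (f≼b , b≼e)) a≼g g≼b with total g f
  ... | inj₁ g≼f = inj₁ (≼-trans e≼a a≼g , g≼f)
  ... | inj₂ f≼g = inj₂ (f≼g , ≼-trans g≼b b≼e)
  between-convex {e = e} {g = g} (inj₂ (f≼a , a≼e)) (inj₁ (e≼b , b≼f)) a≼g g≼b with total g e
  ... | inj₁ g≼e = inj₂ (≼-trans f≼a a≼g , g≼e)
  ... | inj₂ e≼g = inj₁ (e≼g , ≼-trans g≼b b≼f)

  below-between : ∀ {c d t p} → Below p c d → Between c d t → p ≺ t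
  below-between (p≺c , _) (inj₁ (c≼t , _)) = ≺-≼-trans p≺c c≼t
  below-between (_ , p≺d) (inj₂ (d≼t , _)) = ≺-≼-trans p≺d d≼t

  above-between : ∀ {c d t p} → Above p c d → Between c d t → t ≺ p
  above-between (_ , d≺p) (inj₁ (_ , t≼d)) = ≼-≺-trans t≼d d≺p
  above-between (c≺p , _) (inj₂ (_ , t≼c)) = ≼-≺-trans t≼c c≺p

  not-between : ∀ {c d p} → ¬ Between c d p → Below p c d ⊎ Above p c d
  not-between {c} {d} {p} nb with total c p | total d p
  ... | inj₁ c≼p | inj₁ d≼p = inj₂ ((λ p≼c → nb (inj₂ (d≼p , p≼c))) , (λ p≼d → nb (inj₁ (c≼p , p≼d))))
  ... | inj₁ c≼p | inj₂ p≼d = ⊥-elim (nb (inj₁ (c≼p , p≼d)))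
  ... | inj₂ p≼c | inj₁ d≼p = ⊥-elim (nb (inj₂ (d≼p , p≼c)))
  ... | inj₂ p≼c | inj₂ p≼d = inj₁ ((λ c≼p → nb (inj₁ (c≼p , p≼d))) , (λ d≼p → nb (inj₂ (d≼p , p≼c))))

  escape-below : ∀ {c d t p} → Between c d t → p ≺ t → ¬ Between c d p → Below p c d
  escape-below ct p≺t nb with not-between nb
  ... | inj₁ below = below
  ... | inj₂ above = ⊥-elim (≺-asym p≺t (above-between above ct))

  meets-sym : ∀ x y → Meets x y → Meets y x
  meets-sym (ival L a b) (ival L' c d) (e , z , ab , cd) = sym e , z , cd , ab
  meets-sym (ival L₁ a b) (perm p q) m = m
  meets-sym (ival L₂ a b) (perm p q) m = m
  meets-sym (perm p q) (ival L₁ a b) m = m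
  meets-sym (perm p q) (ival L₂ a b) m = m
  meets-sym (perm p q) (perm p' q') (inj₁ m) = inj₂ m
  meets-sym (perm p q) (perm p' q') (inj₂ m) = inj₁ m

  endOn : Line → X → X → X
  endOn L₁ p q = p
  endOn L₂ p q = q

  meets-endOn : ∀ L {c d p q} → Meets (ival L c d) (perm p q) → Between c d (endOn L p q)
  meets-endOn L₁ m = m
  meets-endOn L₂ m = m

  endOn-meets : ∀ L {c d p q} → Between c d (endOn L p q) → Meets (ival L c d) (perm p q)
  endOn-meets L₁ b = b
  endOn-meets L₂ b = b

  -- The open half-strips to the right and to the left of the permutation segment (p, q).
  RightOf : X → X → Seg → Set
  RightOf p q (perm p' q') = p ≺ p' × q ≺ q'
  RightOf p q (ival L c d) = Below (endOn L p q) c d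

  LeftOf : X → X → Seg → Set
  LeftOf p q (perm p' q') = p' ≺ p × q' ≺ q
  LeftOf p q (ival L c d) = Above (endOn L p q) c d

  right-endOn : ∀ L {p q p' q'} → RightOf p q (perm p' q') → endOn L p q ≺ endOn L p' q'
  right-endOn L₁ = proj₁
  right-endOn L₂ = proj₂

  left-endOn : ∀ L {p q p' q'} → LeftOf p q (perm p' q') → endOn L p' q' ≺ endOn L p q
  left-endOn L₁ = proj₁
  left-endOn L₂ = proj₂

  separation : ∀ p q y → ¬ Meets y (perm p q) → RightOf p q y ⊎ LeftOf p q y
  separation p q (ival L c d) nm = not-between (nm ∘ endOn-meets L)
  separation p q (perm p' q') nm with total p p'
  ... | inj₁ p≼p' = inj₁ ((λ p'≼p → nm (inj₁ (p'≼p , ≺⇒≼ q≺q'))) , q≺q')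
    where
    q≺q' : q ≺ q'
    q≺q' q'≼q = nm (inj₂ (p≼p' , q'≼q))
  ... | inj₂ p'≼p = inj₂ ((λ p≼p' → nm (inj₂ (p≼p' , ≺⇒≼ q'≺q))) , q'≺q)
    where
    q'≺q : q' ≺ q
    q'≺q q≼q' = nm (inj₁ (p'≼p , q≼q'))

  opposite-sides-disjoint : ∀ p q x y → RightOf p q x → LeftOf p q y → ¬ Meets x y
  opposite-sides-disjoint p q (perm p' q') (perm p'' q'') (p≺p' , _) (p''≺p , _) (inj₁ (p'≼p'' , _)) =
    ≺-asym (≺-≼-trans p≺p' p'≼p'') p''≺p
  opposite-sides-disjoint p q (perm p' q') (perm p'' q'') (_ , q≺q') (_ , q''≺q) (inj₂ (_ , q'≼q'')) =
    ≺-asym (≺-≼-trans q≺q' q'≼q'') q''≺q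
  opposite-sides-disjoint p q (perm p' q') (ival L c d) r l m =
    ≺-asym (right-endOn L r) (above-between l (meets-endOn L (meets-sym _ (ival L c d) m)))
  opposite-sides-disjoint p q (ival L c d) (perm p' q') r l m =
    ≺-asym (below-between r (meets-endOn L m)) (left-endOn L l)
  opposite-sides-disjoint p q (ival L c d) (ival .L g h) r l (refl , z , cz , gz) =
    ≺-asym (below-between r cz) (above-between l gz)

  right-closed : ∀ p q x y → RightOf p q x → Meets x y → ¬ Meets y (perm p q) → RightOf p q y
  right-closed p q x y rx m nm with separation p q y nm
  ... | inj₁ ry = ry
  ... | inj₂ ly = ⊥-elim (opposite-sides-disjoint p q x y rx ly m)

  left-closed : ∀ p q x y → LeftOf p q x → Meets x y → ¬ Meets y (perm p q) → LeftOf p q y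
  left-closed p q x y lx m nm with separation p q y nm
  ... | inj₁ ry = ⊥-elim (opposite-sides-disjoint p q y x ry lx (meets-sym x y m))
  ... | inj₂ ly = ly

  -- The vertical segment at abscissa c, used as a probe: an interval segment
  -- meets it exactly when the interval contains c.
  vertical : X → Seg
  vertical c = perm c c

  endOn-vertical : ∀ L c → endOn L c c ≡ c
  endOn-vertical L₁ c = refl
  endOn-vertical L₂ c = refl

  interval-line : ∀ y → IsInterval y → Σ Line λ L → OnLine L y
  interval-line (ival L _ _) _ = L , refl

  onLine-interval : ∀ L y → OnLine L y → IsInterval y
  onLine-interval L (ival _ _ _) _ = tt

  line-closed : ∀ L x y → OnLine L x → Meets x y → IsInterval y → OnLine L y
  line-closed L (ival _ _ _) (ival _ _ _) refl (e , _) _ = sym e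

  common-point : ∀ L x y → OnLine L x → OnLine L y → Meets x y →
                 Σ X λ z → Meets x (vertical z) × Meets y (vertical z)
  common-point L₁ (ival L₁ _ _) (ival L₁ _ _) refl refl (_ , z , xz , yz) = z , xz , yz
  common-point L₂ (ival L₂ _ _) (ival L₂ _ _) refl refl (_ , z , xz , yz) = z , xz , yz

  shared-perm-meet : ∀ L x y z → OnLine L x → OnLine L y → IsPerm z → Meets x z → Meets y z → Meets x y
  shared-perm-meet L₁ (ival L₁ _ _) (ival L₁ _ _) (perm p q) refl refl _ xz yz = refl , p , xz , yz
  shared-perm-meet L₂ (ival L₂ _ _) (ival L₂ _ _) (perm p q) refl refl _ xz yz = refl , q , xz , yz
  shared-perm-meet L x y (ival _ _ _) _ _ np _ _ = ⊥-elim (np tt)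

  vertical-at-start : ∀ L c d → Meets (ival L c d) (vertical c)
  vertical-at-start L₁ c d = between-self c d
  vertical-at-start L₂ c d = between-self c d

  right-of-vertical-meets : ∀ L y {c p q} → OnLine L y → RightOf c c y → Meets y (perm p q) → c ≺ endOn L p q
  right-of-vertical-meets L₁ (ival L₁ _ _) refl r m = below-between r m
  right-of-vertical-meets L₂ (ival L₂ _ _) refl r m = below-between r m

  left-of-vertical-meets : ∀ L y {c p q} → OnLine L y → LeftOf c c y → Meets y (perm p q) → endOn L p q ≺ c
  left-of-vertical-meets L₁ (ival L₁ _ _) refl l m = above-between l m
  left-of-vertical-meets L₂ (ival L₂ _ _) refl l m = above-between l m

  right-of-vertical : ∀ L y {c p q} → OnLine L y → Meets y (perm p q) → c ≺ endOn L p q →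
                      ¬ Meets y (vertical c) → RightOf c c y
  right-of-vertical L₁ (ival L₁ _ _) refl m c≺p nm = escape-below m c≺p nm
  right-of-vertical L₂ (ival L₂ _ _) refl m c≺q nm = escape-below m c≺q nm

  spanning-meets : ∀ L y z {a b} → OnLine L y → OnLine L z → Meets y (vertical a) → Meets y (vertical b) →
                   RightOf a a z → LeftOf b b z → Meets y z
  spanning-meets L₁ (ival L₁ _ _) (ival L₁ g h) refl refl ya yb (a≺g , _) (g≺b , _) =
    refl , g , between-convex ya yb (≺⇒≼ a≺g) (≺⇒≼ g≺b) , between-self g h
  spanning-meets L₂ (ival L₂ _ _) (ival L₂ g h) refl refl ya yb (a≺g , _) (g≺b , _) =
    refl , g , between-convex ya yb (≺⇒≼ a≺g) (≺⇒≼ g≺b) , between-self g h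

module Cyclic (O : TotalOrder 0ℓ 0ℓ 0ℓ) (n : ℕ) .{{_ : NonZero n}} where
  open Geometry O using (shift)
  open ≡-Reasoning

  toℕ-shift : ∀ i k → toℕ (shift n i k) ≡ (toℕ i + k) % n
  toℕ-shift i k = toℕ-fromℕ< (m%n<n (toℕ i + k) n)

  %-absorbˡ : ∀ m k → (m % n + k) % n ≡ (m + k) % n
  %-absorbˡ m k = begin
    (m % n + k) % n          ≡⟨ %-distribˡ-+ (m % n) k n ⟩
    (m % n % n + k % n) % n  ≡⟨ cong (λ v → (v + k % n) % n) (m%n%n≡m%n m n) ⟩
    (m % n + k % n) % n      ≡⟨ sym (%-distribˡ-+ m k n) ⟩
    (m + k) % n              ∎

  %-absorbʳ : ∀ m k → (m + k % n) % n ≡ (m + k) % n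
  %-absorbʳ m k = begin
    (m + k % n) % n  ≡⟨ cong (_% n) (+-comm m (k % n)) ⟩
    (k % n + m) % n  ≡⟨ %-absorbˡ k m ⟩
    (k + m) % n      ≡⟨ cong (_% n) (+-comm k m) ⟩
    (m + k) % n      ∎

  shift-shift : ∀ i j k → shift n (shift n i j) k ≡ shift n i (j + k)
  shift-shift i j k = toℕ-injective (begin
    toℕ (shift n (shift n i j) k)  ≡⟨ toℕ-shift (shift n i j) k ⟩
    (toℕ (shift n i j) + k) % n    ≡⟨ cong (λ v → (v + k) % n) (toℕ-shift i j) ⟩
    ((toℕ i + j) % n + k) % n      ≡⟨ %-absorbˡ (toℕ i + j) k ⟩
    (toℕ i + j + k) % n            ≡⟨ cong (_% n) (+-assoc (toℕ i) j k) ⟩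
    (toℕ i + (j + k)) % n          ≡⟨ sym (toℕ-shift i (j + k)) ⟩
    toℕ (shift n i (j + k))        ∎)

  shift-zero : ∀ i → shift n i 0 ≡ i
  shift-zero i = toℕ-injective (begin
    toℕ (shift n i 0)    ≡⟨ toℕ-shift i 0 ⟩
    (toℕ i + 0) % n      ≡⟨ cong (_% n) (+-identityʳ (toℕ i)) ⟩
    toℕ i % n            ≡⟨ m<n⇒m%n≡m (toℕ<n i) ⟩
    toℕ i                ∎)

  shift-period : ∀ i k → shift n i (k + n) ≡ shift n i k
  shift-period i k = toℕ-injective (begin
    toℕ (shift n i (k + n))  ≡⟨ toℕ-shift i (k + n) ⟩
    (toℕ i + (k + n)) % n    ≡⟨ cong (_% n) (sym (+-assoc (toℕ i) k n)) ⟩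
    (toℕ i + k + n) % n      ≡⟨ [m+n]%n≡m%n (toℕ i + k) n ⟩
    (toℕ i + k) % n          ≡⟨ sym (toℕ-shift i k) ⟩
    toℕ (shift n i k)        ∎)

  shift-suc : ∀ i k → shift n i (suc k) ≡ shift n (shift n i k) 1
  shift-suc i k = trans (cong (shift n i) (+-comm 1 k)) (sym (shift-shift i k 1))

  n-1<n : n ∸ 1 < n
  n-1<n = ∸-monoʳ-< {o = 0} z<s (>-nonZero⁻¹ n)

  shift-pred : ∀ i k → shift n (shift n i (suc k)) (n ∸ 1) ≡ shift n i k
  shift-pred i k = begin
    shift n (shift n i (suc k)) (n ∸ 1)  ≡⟨ shift-shift i (suc k) (n ∸ 1) ⟩
    shift n i (suc k + (n ∸ 1))          ≡⟨ cong (shift n i) (trans (sym (+-suc k (n ∸ 1)))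
                                              (cong (k +_) (m+[n∸m]≡n (>-nonZero⁻¹ n)))) ⟩
    shift n i (k + n)                    ≡⟨ shift-period i k ⟩
    shift n i k                          ∎

  offset : Fin n → Fin n → ℕ
  offset i j = (toℕ j + (n ∸ toℕ i)) % n

  offset<n : ∀ i j → offset i j < n
  offset<n i j = m%n<n _ n

  private
    i+[n∸i]≡n : ∀ (i : Fin n) → toℕ i + (n ∸ toℕ i) ≡ n
    i+[n∸i]≡n i = m+[n∸m]≡n (<⇒≤ (toℕ<n i))

    cancel : ∀ (i : Fin n) k → (toℕ i + k + (n ∸ toℕ i)) % n ≡ k % n
    cancel i k = begin
      (toℕ i + k + (n ∸ toℕ i)) % n    ≡⟨ cong (λ v → (v + (n ∸ toℕ i)) % n) (+-comm (toℕ i) k) ⟩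
      (k + toℕ i + (n ∸ toℕ i)) % n    ≡⟨ cong (_% n) (+-assoc k (toℕ i) (n ∸ toℕ i)) ⟩
      (k + (toℕ i + (n ∸ toℕ i))) % n  ≡⟨ cong (λ v → (k + v) % n) (i+[n∸i]≡n i) ⟩
      (k + n) % n                      ≡⟨ [m+n]%n≡m%n k n ⟩
      k % n                            ∎

  offset-shift : ∀ i k → k < n → offset i (shift n i k) ≡ k
  offset-shift i k k<n = begin
    (toℕ (shift n i k) + (n ∸ toℕ i)) % n  ≡⟨ cong (λ v → (v + (n ∸ toℕ i)) % n) (toℕ-shift i k) ⟩
    ((toℕ i + k) % n + (n ∸ toℕ i)) % n    ≡⟨ %-absorbˡ (toℕ i + k) (n ∸ toℕ i) ⟩
    (toℕ i + k + (n ∸ toℕ i)) % n          ≡⟨ cancel i k ⟩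
    k % n                                  ≡⟨ m<n⇒m%n≡m k<n ⟩
    k                                      ∎

  shift-offset : ∀ i j → shift n i (offset i j) ≡ j
  shift-offset i j = toℕ-injective (begin
    toℕ (shift n i (offset i j))              ≡⟨ toℕ-shift i (offset i j) ⟩
    (toℕ i + (toℕ j + (n ∸ toℕ i)) % n) % n   ≡⟨ %-absorbʳ (toℕ i) (toℕ j + (n ∸ toℕ i)) ⟩
    (toℕ i + (toℕ j + (n ∸ toℕ i))) % n       ≡⟨ cong (_% n) (sym (+-assoc (toℕ i) (toℕ j) (n ∸ toℕ i))) ⟩
    (toℕ i + toℕ j + (n ∸ toℕ i)) % n         ≡⟨ cancel i (toℕ j) ⟩
    toℕ j % n                                 ≡⟨ m<n⇒m%n≡m (toℕ<n j) ⟩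
    toℕ j                                     ∎)

  shift-injective : ∀ i {k k'} → k < n → k' < n → shift n i k ≡ shift n i k' → k ≡ k'
  shift-injective i {k} {k'} k<n k'<n e =
    trans (sym (offset-shift i k k<n)) (trans (cong (offset i) e) (offset-shift i k' k'<n))

least : (P : ℕ → Set) → (∀ k → Dec (P k)) → ∀ m → P m →
        Σ ℕ λ k → P k × (∀ j → j < k → ¬ P j) × k ≤ m
least P P? zero p0 = 0 , p0 , (λ _ ()) , z≤n
least P P? (suc m) pm with P? 0
... | yes p0 = 0 , p0 , (λ _ ()) , z≤n
... | no ¬p0 with least (P ∘ suc) (P? ∘ suc) m pm
...   | k , pk , below-k , k≤m = suc k , pk , minimal , s≤s k≤m
  where
  minimal : ∀ j → j < suc k → ¬ P j
  minimal zero _ = ¬p0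
  minimal (suc j) (s≤s j<k) = below-k j j<k

module CycleModel (O : TotalOrder 0ℓ 0ℓ 0ℓ) (n : ℕ) .{{_ : NonZero n}} (n≥4 : 4 ≤ n)
                  (s : Fin n → Geometry.Seg O) (model : Geometry.IsModel O n s) where
  open TotalOrder O using () renaming (Carrier to X)
  open Geometry O
  open Plane O
  open Cyclic O n

  seg : Fin n → ℕ → Seg
  seg i k = s (shift n i k)

  seg-period : ∀ i → seg i n ≡ seg i 0
  seg-period i = cong s (shift-period i 0)

  successor-distinct : ∀ x → ¬ x ≡ shift n x 1
  successor-distinct x x≡x+1 with m≤n⇒m<n∨m≡n (toℕ<n x)
  ... | inj₁ x+1<n = <-irrefl toℕx≡x+1 (n<1+n (toℕ x))
    where
    toℕx≡x+1 : toℕ x ≡ suc (toℕ x)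
    toℕx≡x+1 = trans (cong toℕ x≡x+1) (trans (toℕ-shift x 1)
                 (trans (cong (_% n) (+-comm (toℕ x) 1)) (m<n⇒m%n≡m x+1<n)))
  ... | inj₂ x+1≡n = <-irrefl n≡1 (≤-trans (s≤s (s≤s z≤n)) n≥4)
    where
    toℕx≡0 : toℕ x ≡ 0
    toℕx≡0 = trans (cong toℕ x≡x+1) (trans (toℕ-shift x 1)
               (trans (cong (_% n) (trans (+-comm (toℕ x) 1) x+1≡n)) (n%n≡0 n)))
    n≡1 : 1 ≡ n
    n≡1 = trans (cong suc (sym toℕx≡0)) x+1≡n

  consecutive-meet : ∀ i k → Meets (seg i k) (seg i (suc k))
  consecutive-meet i k = proj₂ (model _ _ distinct) (inj₁ (shift-suc i k))
    where
    distinct : ¬ shift n i k ≡ shift n i (suc k)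
    distinct e = successor-distinct (shift n i k) (trans e (shift-suc i k))

  wrap-meet : ∀ i → Meets (seg i (n ∸ 1)) (seg i 0)
  wrap-meet i = subst (Meets (seg i (n ∸ 1))) (trans (cong (seg i) (m+[n∸m]≡n (>-nonZero⁻¹ n))) (seg-period i))
                  (consecutive-meet i (n ∸ 1))

  nonconsecutive-disjoint : ∀ i {k k'} → suc k < k' → k' < n → (suc k' < n ⊎ 0 < k) →
                            ¬ Meets (seg i k) (seg i k')
  nonconsecutive-disjoint i {k} {k'} k+1<k' k'<n far m = not-adjacent (proj₁ (model _ _ distinct) m)
    where
    k<k' : k < k'
    k<k' = <-trans (n<1+n k) k+1<k'
    k<n : k < n
    k<n = <-trans k<k' k'<n
    distinct : ¬ shift n i k ≡ shift n i k'
    distinct e = <⇒≢ k<k' (shift-injective i k<n k'<n e)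
    -- k is not the successor of k' modulo n: when k' + 1 = n this uses k ≠ 0
    not-after : (suc k' < n ⊎ 0 < k) → ¬ shift n i k ≡ shift n i (suc k')
    not-after far' e with m≤n⇒m<n∨m≡n k'<n | far'
    ... | inj₁ k'+1<n | _ = <⇒≢ (<-trans k<k' (n<1+n k')) (shift-injective i k<n k'+1<n e)
    ... | inj₂ k'+1≡n | inj₁ k'+1<n = <-irrefl k'+1≡n k'+1<n
    ... | inj₂ k'+1≡n | inj₂ 0<k = <⇒≢ 0<k (sym (shift-injective i k<n (>-nonZero⁻¹ n)
                                     (trans e (trans (cong (shift n i) k'+1≡n) (shift-period i 0)))))
    not-adjacent : ¬ CycleAdj n (shift n i k) (shift n i k')
    not-adjacent (inj₁ e) = <⇒≢ k+1<k'
      (sym (shift-injective i k'<n (<-trans k+1<k' k'<n) (trans e (sym (shift-suc i k)))))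
    not-adjacent (inj₂ e) = not-after far (trans e (sym (shift-suc i k')))

  Closed : (Seg → Set) → (Seg → Set) → Set
  Closed P Q = ∀ x y → P x → Meets x y → Q y → P y

  propagate-up : ∀ {P Q} → Closed P Q → ∀ i {m m'} → m ≤ m' → P (seg i m) →
                 (∀ k → m < k → k ≤ m' → Q (seg i k)) → P (seg i m')
  propagate-up cl i {m} {zero} z≤n pm q = pm
  propagate-up {P} cl i {m} {suc m'} m≤m'+1 pm q with m ≤? m'
  ... | yes m≤m' = cl _ _ (propagate-up cl i m≤m' pm (λ k m<k k≤m' → q k m<k (m≤n⇒m≤1+n k≤m')))
                          (consecutive-meet i m') (q (suc m') (s≤s m≤m') ≤-refl)
  ... | no m≰m' = subst (P ∘ seg i) (≤-antisym m≤m'+1 (≰⇒> m≰m')) pm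

  propagate-down : ∀ {P Q} → Closed P Q → ∀ i {m m'} → m ≤ m' → P (seg i m') →
                   (∀ k → m ≤ k → k < m' → Q (seg i k)) → P (seg i m)
  propagate-down cl i {m} {zero} z≤n pm' q = pm'
  propagate-down {P} cl i {m} {suc m'} m≤m'+1 pm' q with m ≤? m'
  ... | yes m≤m' = propagate-down cl i m≤m' (cl _ _ pm' (meets-sym _ _ (consecutive-meet i m')) (q m' m≤m' ≤-refl))
                     (λ k m≤k k<m' → q k m≤k (m<n⇒m<1+n k<m'))
  ... | no m≰m' = subst (P ∘ seg i) (sym (≤-antisym m≤m'+1 (≰⇒> m≰m'))) pm'

  -- If every segment were an interval segment, all would lie on one line and seg 1 would
  -- meet seg 3: with t₀ ∈ seg 0 ∩ seg 1 and t₂ ∈ seg 1 ∩ seg 2, seg 3 is reached from seg 2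
  -- without crossing the vertical at t₀ and from seg 0 without crossing the vertical at t₂,
  -- so either t₀, t₂ are ordered both ways, or seg 3 lies between them inside seg 1.
  module AllIntervals (i : Fin n) (all-interval : ∀ x → IsInterval (s x)) where
    L : Line
    L = proj₁ (interval-line (seg i 0) (all-interval _))

    on : ∀ k → OnLine L (seg i k)
    on k = propagate-up (line-closed L) i z≤n (proj₂ (interval-line (seg i 0) (all-interval _)))
             (λ _ _ _ → all-interval _)

    t₀ t₂ : X
    t₀ = proj₁ (common-point L (seg i 0) (seg i 1) (on 0) (on 1) (consecutive-meet i 0))
    t₂ = proj₁ (common-point L (seg i 1) (seg i 2) (on 1) (on 2) (consecutive-meet i 1))

    seg0-t₀ : Meets (seg i 0) (vertical t₀)
    seg0-t₀ = proj₁ (proj₂ (common-point L (seg i 0) (seg i 1) (on 0) (on 1) (consecutive-meet i 0)))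
    seg1-t₀ : Meets (seg i 1) (vertical t₀)
    seg1-t₀ = proj₂ (proj₂ (common-point L (seg i 0) (seg i 1) (on 0) (on 1) (consecutive-meet i 0)))
    seg1-t₂ : Meets (seg i 1) (vertical t₂)
    seg1-t₂ = proj₁ (proj₂ (common-point L (seg i 1) (seg i 2) (on 1) (on 2) (consecutive-meet i 1)))
    seg2-t₂ : Meets (seg i 2) (vertical t₂)
    seg2-t₂ = proj₂ (proj₂ (common-point L (seg i 1) (seg i 2) (on 1) (on 2) (consecutive-meet i 1)))

    meet-at : ∀ k k' {t} → Meets (seg i k) (vertical t) → Meets (seg i k') (vertical t) → Meets (seg i k) (seg i k')
    meet-at k k' = shared-perm-meet L (seg i k) (seg i k') _ (on k) (on k') (λ ())

    seg1-far : ∀ k → 3 ≤ k → k < n → ¬ Meets (seg i 1) (seg i k)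
    seg1-far k 3≤k k<n = nonconsecutive-disjoint i 3≤k k<n (inj₂ z<s)

    seg0-seg2 : ¬ Meets (seg i 0) (seg i 2)
    seg0-seg2 = nonconsecutive-disjoint i (s<s z<s) (<-trans (n<1+n 2) n≥4) (inj₁ n≥4)

    seg2-avoids-t₀ : ¬ Meets (seg i 2) (vertical t₀)
    seg2-avoids-t₀ m = seg0-seg2 (meet-at 0 2 seg0-t₀ m)

    seg0-avoids-t₂ : ¬ Meets (seg i 0) (vertical t₂)
    seg0-avoids-t₂ m = seg0-seg2 (meet-at 0 2 m seg2-t₂)

    seg3-avoids-t₀ : ¬ Meets (seg i 3) (vertical t₀)
    seg3-avoids-t₀ m = seg1-far 3 ≤-refl n≥4 (meet-at 1 3 seg1-t₀ m)

    avoids-t₂ : ∀ k → 3 ≤ k → k < n → ¬ Meets (seg i k) (vertical t₂)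
    avoids-t₂ k 3≤k k<n m = seg1-far k 3≤k k<n (meet-at 1 k seg1-t₂ m)

    right-reach : ∀ k {c t} → RightOf c c (seg i k) → Meets (seg i k) (vertical t) → c ≺ t
    right-reach k {c} {t} r m = subst (c ≺_) (endOn-vertical L t) (right-of-vertical-meets L (seg i k) (on k) r m)

    left-reach : ∀ k {c t} → LeftOf c c (seg i k) → Meets (seg i k) (vertical t) → t ≺ c
    left-reach k {c} {t} l m = subst (_≺ c) (endOn-vertical L t) (left-of-vertical-meets L (seg i k) (on k) l m)

    back-to-3 : ∀ {P} → Closed P (λ y → ¬ Meets y (vertical t₂)) → P (seg i 0) → P (seg i 3)
    back-to-3 {P} cl p0 = propagate-down cl i (<⇒≤ n≥4) (subst P (sym (seg-period i)) p0) avoids-t₂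

    impossible : ⊥
    impossible with separation t₀ t₀ (seg i 2) seg2-avoids-t₀ | separation t₂ t₂ (seg i 0) seg0-avoids-t₂
    ... | inj₁ r₂ | inj₁ r₀ = ≺-asym (right-reach 2 r₂ seg2-t₂) (right-reach 0 r₀ seg0-t₀)
    ... | inj₂ l₂ | inj₂ l₀ = ≺-asym (left-reach 2 l₂ seg2-t₂) (left-reach 0 l₀ seg0-t₀)
    ... | inj₁ r₂ | inj₂ l₀ = seg1-far 3 ≤-refl n≥4 (spanning-meets L (seg i 1) (seg i 3) (on 1) (on 3) seg1-t₀ seg1-t₂
        (right-closed t₀ t₀ _ _ r₂ (consecutive-meet i 2) seg3-avoids-t₀) (back-to-3 (left-closed t₂ t₂) l₀))
    ... | inj₂ l₂ | inj₁ r₀ = seg1-far 3 ≤-refl n≥4 (spanning-meets L (seg i 1) (seg i 3) (on 1) (on 3) seg1-t₂ seg1-t₀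
        (back-to-3 (right-closed t₂ t₂) r₀) (left-closed t₀ t₀ _ _ l₂ (consecutive-meet i 2) seg3-avoids-t₀))

  not-all-interval : Fin n → ¬ (∀ x → IsInterval (s x))
  not-all-interval i all-interval = AllIntervals.impossible i all-interval

  interval? : ∀ y → Dec (IsInterval y)
  interval? (ival _ _ _) = yes tt
  interval? (perm _ _) = no (λ ())

  not-perm : ∀ y → ¬ IsPerm y → IsInterval y
  not-perm (ival _ _ _) _ = tt
  not-perm (perm _ _) ¬perm = ⊥-elim (¬perm (λ ()))

  perm-form : ∀ y → IsPerm y → Σ X λ p → Σ X λ q → y ≡ perm p q
  perm-form (ival _ _ _) ¬int = ⊥-elim (¬int tt)
  perm-form (perm p q) _ = p , q , refl

  interval-form : ∀ L y → OnLine L y → Σ X λ c → Σ X λ d → y ≡ ival L c d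
  interval-form L (ival _ c d) refl = c , d , refl

  ArcStart : Fin n → Set
  ArcStart j = IsInterval (s j) × IsPerm (seg j (n ∸ 1))

  arc-start? : ∀ j → Dec (ArcStart j)
  arc-start? j = interval? (s j) ×-dec ¬? (interval? (seg j (n ∸ 1)))

  arc-start : ∀ {j m} → IsArc n s j m → ArcStart j
  arc-start {j} (1≤m , _ , int , _ , pred-perm) = subst (IsInterval ∘ s) (shift-zero j) (int 0 1≤m) , pred-perm

  arc-from : ∀ j → ArcStart j → Σ ℕ (IsArc n s j)
  arc-from j (int , pred-perm) with least (λ t → IsPerm (seg j t)) (λ t → ¬? (interval? (seg j t))) (n ∸ 1) pred-perm
  ... | zero , perm0 , _ , _ = ⊥-elim (subst (IsPerm ∘ s) (shift-zero j) perm0 int)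
  ... | suc t , perm-t , before-t , t<n = suc t , s≤s z≤n , ≤-<-trans t<n n-1<n ,
          (λ k k<t → not-perm _ (before-t k k<t)) , perm-t , pred-perm

  arc-start-exists : ∀ {i p} → IsInterval (s i) → IsPerm (s p) → Σ (Fin n) ArcStart
  arc-start-exists {i} {p} int-i perm-p
    with least (IsInterval ∘ seg p) (interval? ∘ seg p) (offset p i) (subst (IsInterval ∘ s) (sym (shift-offset p i)) int-i)
  ... | zero , int0 , _ , _ = ⊥-elim (perm-p (subst (IsInterval ∘ s) (shift-zero p) int0))
  ... | suc k , int-k , before-k , _ =
          shift n p (suc k) , int-k , subst (IsPerm ∘ s) (sym (shift-pred p k)) (before-k k (n<1+n k))

  arc-length-unique : ∀ {j m m'} → IsArc n s j m → IsArc n s j m' → m ≡ m'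
  arc-length-unique {m = m} {m'} (_ , _ , int , end-perm , _) (_ , _ , int' , end-perm' , _) with <-cmp m m'
  ... | tri< m<m' _ _ = ⊥-elim (end-perm (int' m m<m'))
  ... | tri≈ _ m≡m' _ = m≡m'
  ... | tri> _ _ m'<m = ⊥-elim (end-perm' (int m' m'<m))

  arc-line : ∀ {j m} → IsArc n s j m → Σ Line (ArcOn n s j m)
  arc-line {j} {m} (1≤m , _ , int , _ , _) = L , λ k k<m →
      propagate-up (line-closed L) j z≤n (proj₂ start-line) (λ k' _ k'≤k → int k' (≤-<-trans k'≤k k<m))
    where
    start-line : Σ Line λ L → OnLine L (seg j 0)
    start-line = interval-line (seg j 0) (int 0 1≤m)
    L : Line
    L = proj₁ start-line

  -- Let an arc occupy positions 0, …, l after a, all on line L,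
  -- bounded by the permutation segments π₂ = seg a (l + 1) and π₁ = seg a (n - 1), and let
  -- W = [c, d] on L sit at a position β at distance ≥ 2 from both.  Then W avoids π₁, π₂.
  -- If W is on the same side of both, the paths from W to π₁ (avoiding π₂) and to π₂
  -- (avoiding π₁) put π₁ and π₂ on opposite sides of each other.  Otherwise c lies strictly
  -- between the ends of π₁, π₂ on L, and the arc, which avoids the vertical at c (else it
  -- would meet W), runs from π₁ to π₂ on one side of that vertical: impossible.
  module FarFromArc {a l L β} (on-L : ArcOn n s a (suc l) L)
                    (after-arc : suc (suc l) < β) (before-end : suc (suc β) < n)
                    {c d} (W≡ : seg a β ≡ ival L c d)
                    {p₂ q₂} (π₂≡ : seg a (suc l) ≡ perm p₂ q₂)
                    {p₁ q₁} (π₁≡ : seg a (n ∸ 1) ≡ perm p₁ q₁) where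
    β<n : β < n
    β<n = <-trans (<-trans (n<1+n β) (n<1+n (suc β))) before-end

    β+1<n-1 : suc β < n ∸ 1
    β+1<n-1 = ≤-trans (s≤s (s≤s ≤-refl)) (∸-monoˡ-≤ 1 before-end)

    to-π₂ : ∀ {y} → Meets y (seg a (suc l)) → Meets y (perm p₂ q₂)
    to-π₂ {y} = subst (Meets y) π₂≡

    to-π₁ : ∀ {y} → Meets y (seg a (n ∸ 1)) → Meets y (perm p₁ q₁)
    to-π₁ {y} = subst (Meets y) π₁≡

    after-W-avoid-π₂ : ∀ k → β ≤ k → k ≤ n ∸ 1 → ¬ Meets (seg a k) (perm p₂ q₂)
    after-W-avoid-π₂ k β≤k k≤n-1 m = nonconsecutive-disjoint a (<-≤-trans after-arc β≤k) (≤-<-trans k≤n-1 n-1<n)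
      (inj₂ z<s) (meets-sym _ _ (subst (Meets (seg a k)) (sym π₂≡) m))

    before-W-avoid-π₁ : ∀ k → suc l ≤ k → k ≤ β → ¬ Meets (seg a k) (perm p₁ q₁)
    before-W-avoid-π₁ k ℓ≤k k≤β m = nonconsecutive-disjoint a (≤-<-trans (s≤s k≤β) β+1<n-1) n-1<n
      (inj₂ (<-≤-trans z<s ℓ≤k)) (subst (Meets (seg a k)) (sym π₁≡) m)

    arc-avoids-c : ∀ k → k < suc l → ¬ Meets (seg a k) (vertical c)
    arc-avoids-c k k<ℓ m = nonconsecutive-disjoint a (<-trans (s≤s k<ℓ) after-arc) β<n
      (inj₁ (<-trans (n<1+n (suc β)) before-end))
      (shared-perm-meet L (seg a k) (seg a β) (vertical c) (on-L k k<ℓ)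
        (subst (OnLine L) (sym W≡) refl) (λ ()) m (subst (λ y → Meets y (vertical c)) (sym W≡) (vertical-at-start L c d)))

    first-meets-π₁ : Meets (seg a 0) (perm p₁ q₁)
    first-meets-π₁ = to-π₁ (meets-sym _ _ (wrap-meet a))

    last-meets-π₂ : Meets (seg a l) (perm p₂ q₂)
    last-meets-π₂ = to-π₂ (consecutive-meet a l)

    towards-π₁ : ∀ {P} → Closed P (λ y → ¬ Meets y (perm p₂ q₂)) → P (seg a β) → P (perm p₁ q₁)
    towards-π₁ {P} cl pW = subst P π₁≡ (propagate-up cl a (<⇒≤ (<-trans (n<1+n β) β+1<n-1)) pW
                             (λ k β<k k≤n-1 → after-W-avoid-π₂ k (<⇒≤ β<k) k≤n-1))

    towards-π₂ : ∀ {P} → Closed P (λ y → ¬ Meets y (perm p₁ q₁)) → P (seg a β) → P (perm p₂ q₂)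
    towards-π₂ {P} cl pW = subst P π₂≡ (propagate-down cl a (<⇒≤ (<-trans (n<1+n (suc l)) after-arc)) pW
                             (λ k ℓ≤k k<β → before-W-avoid-π₁ k ℓ≤k (<⇒≤ k<β)))

    on-first : OnLine L (seg a 0)
    on-first = on-L 0 z<s

    on-last : OnLine L (seg a l)
    on-last = on-L l (n<1+n l)

    impossible : ⊥
    impossible with separation p₂ q₂ (seg a β) (after-W-avoid-π₂ β ≤-refl (<⇒≤ (<-trans (n<1+n β) β+1<n-1)))
                  | separation p₁ q₁ (seg a β) (before-W-avoid-π₁ β (<⇒≤ (<-trans (n<1+n (suc l)) after-arc)) ≤-refl)
    ... | inj₁ r₂ | inj₁ r₁ = ≺-asym (proj₁ (towards-π₁ (right-closed p₂ q₂) r₂)) (proj₁ (towards-π₂ (right-closed p₁ q₁) r₁))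
    ... | inj₂ l₂ | inj₂ l₁ = ≺-asym (proj₁ (towards-π₁ (left-closed p₂ q₂) l₂)) (proj₁ (towards-π₂ (left-closed p₁ q₁) l₁))
    ... | inj₁ r₂ | inj₂ l₁ = ≺-asym π₂≺c (right-of-vertical-meets L (seg a l) on-last last-right last-meets-π₂)
      where
      π₂≺c : endOn L p₂ q₂ ≺ c
      π₂≺c = proj₁ (subst (RightOf p₂ q₂) W≡ r₂)
      first-right : RightOf c c (seg a 0)
      first-right = right-of-vertical L (seg a 0) on-first first-meets-π₁ (proj₁ (subst (LeftOf p₁ q₁) W≡ l₁))
                      (arc-avoids-c 0 z<s)
      last-right : RightOf c c (seg a l)
      last-right = propagate-up (right-closed c c) a z≤n first-right (λ k _ k≤l → arc-avoids-c k (s≤s k≤l))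
    ... | inj₂ l₂ | inj₁ r₁ = ≺-asym π₁≺c (right-of-vertical-meets L (seg a 0) on-first first-right first-meets-π₁)
      where
      π₁≺c : endOn L p₁ q₁ ≺ c
      π₁≺c = proj₁ (subst (RightOf p₁ q₁) W≡ r₁)
      last-right : RightOf c c (seg a l)
      last-right = right-of-vertical L (seg a l) on-last last-meets-π₂ (proj₁ (subst (LeftOf p₂ q₂) W≡ l₂))
                     (arc-avoids-c l (n<1+n l))
      first-right : RightOf c c (seg a 0)
      first-right = propagate-down (right-closed c c) a z≤n last-right (λ k _ k<l → arc-avoids-c k (m<n⇒m<1+n k<l))

  -- Next to the arc this
  -- is because it would meet the arc through the bounding permutation segment; further
  -- away it is the lemma above.
  outside-arc-off-line : ∀ {a ℓ L} → IsArc n s a ℓ → ArcOn n s a ℓ L →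
                         ∀ β → ℓ ≤ β → β < n → ¬ OnLine L (seg a β)
  outside-arc-off-line {ℓ = zero} (() , _) _ _ _ _ _
  outside-arc-off-line {a} {suc l} {L} (_ , _ , _ , π₂-perm , π₁-perm) on-L β ℓ≤β β<n on-β
    with β ≟ suc l | suc β ≟ n | β ≟ suc (suc l) | suc (suc β) ≟ n
  ... | yes β≡ℓ | _ | _ | _ = π₂-perm (onLine-interval L _ (subst (OnLine L ∘ seg a) β≡ℓ on-β))
  ... | no _ | yes β+1≡n | _ | _ = π₁-perm (onLine-interval L _ (subst (OnLine L ∘ seg a) (cong (_∸ 1) β+1≡n) on-β))
  ... | no _ | no β+1≢n | yes refl | _ =
    nonconsecutive-disjoint a (n<1+n (suc l)) β<n (inj₁ (≤∧≢⇒< β<n β+1≢n))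
      (shared-perm-meet L (seg a l) (seg a β) (seg a (suc l)) (on-L l (n<1+n l)) on-β π₂-perm
        (consecutive-meet a l) (meets-sym _ _ (consecutive-meet a (suc l))))
  ... | no β≢ℓ | no β+1≢n | no β≢ℓ+1 | yes β+2≡n =
    nonconsecutive-disjoint a (<-trans (s≤s (s≤s z≤n)) ℓ+1<β) β<n (inj₁ (≤∧≢⇒< β<n β+1≢n))
      (shared-perm-meet L (seg a 0) (seg a β) (seg a (n ∸ 1)) (on-L 0 z<s) on-β π₁-perm
        (meets-sym _ _ (wrap-meet a)) (subst (Meets (seg a β) ∘ seg a) (cong (_∸ 1) β+2≡n) (consecutive-meet a β)))
    where
    ℓ+1<β : suc (suc l) < β
    ℓ+1<β = ≤∧≢⇒< (≤∧≢⇒< ℓ≤β (β≢ℓ ∘ sym)) (β≢ℓ+1 ∘ sym)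
  ... | no β≢ℓ | no β+1≢n | no β≢ℓ+1 | no β+2≢n =
    FarFromArc.impossible on-L (≤∧≢⇒< (≤∧≢⇒< ℓ≤β (β≢ℓ ∘ sym)) (β≢ℓ+1 ∘ sym))
      (≤∧≢⇒< (≤∧≢⇒< β<n β+1≢n) β+2≢n)
      (proj₂ (proj₂ (interval-form L _ on-β)))
      (proj₂ (proj₂ (perm-form _ π₂-perm)))
      (proj₂ (proj₂ (perm-form _ π₁-perm)))

  -- Two arcs on the same line coincide: the start b of the second lies on the line of the
  -- first arc, hence inside it, and a vertex inside an arc other than its start has an
  -- interval segment as predecessor.
  one-arc-per-line : ∀ {a ℓ b m L} → IsArc n s a ℓ → ArcOn n s a ℓ L → IsArc n s b m → ArcOn n s b m L →
                     b ≡ a × m ≡ ℓ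
  one-arc-per-line {a} {ℓ} {b} {m} {L} A@(_ , _ , int , _ , _) on-A B@(1≤m , _) on-B =
    sym a≡b , arc-length-unique (subst (λ j → IsArc n s j m) (sym a≡b) B) A
    where
    b-on-L : OnLine L (seg a (offset a b))
    b-on-L = subst (OnLine L ∘ s) (trans (shift-zero b) (sym (shift-offset a b))) (on-B 0 1≤m)

    start-in-arc : ∀ k → k < ℓ → shift n a k ≡ b → a ≡ b
    start-in-arc zero _ a≡b = trans (sym (shift-zero a)) a≡b
    start-in-arc (suc k) k+1<ℓ e = ⊥-elim (proj₂ (arc-start B)
      (subst (λ j → IsInterval (seg j (n ∸ 1))) e
        (subst (IsInterval ∘ s) (sym (shift-pred a k)) (int k (<-trans (n<1+n k) k+1<ℓ)))))

    a≡b : a ≡ b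
    a≡b with offset a b <? ℓ
    ... | yes β<ℓ = start-in-arc (offset a b) β<ℓ (shift-offset a b)
    ... | no β≮ℓ = ⊥-elim (outside-arc-off-line A on-A (offset a b) (≮⇒≥ β≮ℓ) (offset<n a b) b-on-L)

  on-both-lines : ∀ y → OnLine L₁ y → ¬ OnLine L₂ y
  on-both-lines (ival _ _ _) refl ()

  two-arcs : ∀ {a ℓ b m} → IsArc n s a ℓ → ArcOn n s a ℓ L₁ → IsArc n s b m → ArcOn n s b m L₂ →
             ExactlyTwoArcsOnDifferentLines n s
  two-arcs {a} {ℓ} {b} {m} A on-A B on-B = a , ℓ , b , m , A , B , a≢b , on-A , on-B , classify
    where
    a≢b : ¬ a ≡ b
    a≢b a≡b = on-both-lines (seg a 0) (on-A 0 (proj₁ A))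
                (subst (λ j → OnLine L₂ (seg j 0)) (sym a≡b) (on-B 0 (proj₁ B)))
    classify : ∀ j m' → IsArc n s j m' → (j ≡ a × m' ≡ ℓ) ⊎ (j ≡ b × m' ≡ m)
    classify j m' C with arc-line C
    ... | L₁ , on-C = inj₁ (one-arc-per-line A on-A C on-C)
    ... | L₂ , on-C = inj₂ (one-arc-per-line B on-B C on-C)

  arcs-classified : ∀ {a ℓ} → IsArc n s a ℓ → ExactlyOneArc n s ⊎ ExactlyTwoArcsOnDifferentLines n s
  arcs-classified {a} {ℓ} A with any? (λ j → ¬? (j ≟F a) ×-dec arc-start? j)
  ... | no no-other = inj₁ (a , ℓ , A , unique)
    where
    unique : ∀ j m → IsArc n s j m → j ≡ a × m ≡ ℓ
    unique j m C with j ≟F a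
    ... | yes j≡a = j≡a , arc-length-unique (subst (λ j → IsArc n s j m) j≡a C) A
    ... | no j≢a = ⊥-elim (no-other (j , j≢a , arc-start C))
  ... | yes (b , b≢a , b-start) with arc-from b b-start
  ...   | m , B with arc-line A | arc-line B
  ...     | L₁ , on-A | L₂ , on-B = inj₂ (two-arcs A on-A B on-B)
  ...     | L₂ , on-A | L₁ , on-B = inj₂ (two-arcs B on-B A on-A)
  ...     | L₁ , on-A | L₁ , on-B = ⊥-elim (b≢a (proj₁ (one-arc-per-line A on-A B on-B)))
  ...     | L₂ , on-A | L₂ , on-B = ⊥-elim (b≢a (proj₁ (one-arc-per-line A on-A B on-B)))

  some-arc : ∀ i → IsInterval (s i) → Σ (Fin n) λ a → Σ ℕ (IsArc n s a)
  some-arc i int-i with any? (λ x → ¬? (interval? (s x)))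
  ... | no no-perm = ⊥-elim (not-all-interval i (λ x → not-perm _ (λ perm-x → no-perm (x , perm-x))))
  ... | yes (p , perm-p) with arc-start-exists int-i perm-p
  ...   | a , a-start = a , arc-from a a-start

lemma4 : (O : TotalOrder 0ℓ 0ℓ 0ℓ) → (n : ℕ) → .{{_ : NonZero n}} → 4 ≤ n →
    (s : Fin n → Geometry.Seg O) → Geometry.IsModel O n s →
    ∃[ i ] Geometry.IsInterval O (s i) →
    Geometry.ExactlyOneArc O n s ⊎ Geometry.ExactlyTwoArcsOnDifferentLines O n s
lemma4 O n n≥4 s model (i , int-i) = arcs-classified (proj₂ (proj₂ (some-arc i int-i)))
  where open CycleModel O n n≥4 s model
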